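{- Let $G_1$ and $G_2$ be looped simple graphs. The following are equivalent: (1) up to isomorphism, $G_2$ can be obtained from $G_1$ using edge pivots; (2) there is a compatible isomorphism $\beta:M(IAS(G_1))\to M(IAS(G_2))$ such that $f_\beta(v)\in\{1,(\phi\psi)\}$ for every looped $v\in V(G_1)$ and $f_\beta(v)\in\{1,(\phi\chi)\}$ for every unlooped $v\in V(G_1)$.
   Context: A looped simple graph is a finite graph in which each vertex may carry at most one loop and distinct non-loop edges join distinct pairs of vertices. The simple local complement $G^v_s$ complements all adjacencies between distinct neighbors of $v$. For neighbors $v\ne w$, the edge pivot is $G^{vw}=((G^v_s)^w_s)^v_s$; edge pivots are allowed on any edge, regardless of loops. $A(G)$ is the adjacency matrix over $GF(2)$ (diagonal $1$ iff looped). $M(IAS(G))$ is the binary matroid represented by the columns of $(I\mid A(G)\mid I+A(G))$; its ground set consists of columns $v_\phi,v_\chi,v_\psi$, the columns of $v$ in $I$, $A(G)$, $I+A(G)$. $S_3$ is the permutation group of $\{\phi,\chi,\psi\}$. A compatible isomorphism $\beta$ is a matroid isomorphism mapping each cell $\{v_\phi,v_\chi,v_\psi\}$ onto some cell; it induces a bijection $\beta:V(G_1)\to V(G_2)$ and $f_\beta:V(G_1)\to S_3$ with $\beta(v_\iota)=\beta(v)_{f_\beta(v)(\iota)}$. -}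

module Defs where

open import Data.Bool using (Bool; true; false; _xor_; _∧_; not)
open import Data.Nat using (ℕ; zero; suc)
open import Data.Fin using (Fin; zero; suc; _≟_)
open import Data.Product using (Σ; ∃; _×_; _,_; proj₁; proj₂)
open import Data.Sum using (_⊎_)
open import Relation.Binary.PropositionalEquality using (_≡_; _≢_)
open import Relation.Nullary using (¬_)
open import Relation.Nullary.Decidable using (⌊_⌋)
open import Relation.Binary.Construct.Closure.ReflexiveTransitive using (Star)
open import Function.Bundles using (Inverse; _↔_)

-- Looped simple graphs on vertex set Fin n, given by their adjacency
-- matrix over GF(2) = Bool (with _xor_ as addition).  The diagonal entry
-- A v v is true iff v carries a loop.  A looped simple graph is a
-- symmetric such matrix.

Mat : ℕ → Set
Mat n = Fin n → Fin n → Bool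

Symmetric : ∀ {n} → Mat n → Set
Symmetric A = ∀ i j → A i j ≡ A j i

Looped : ∀ {n} → Mat n → Fin n → Set
Looped A v = A v v ≡ true

Unlooped : ∀ {n} → Mat n → Fin n → Set
Unlooped A v = A v v ≡ false

neq : ∀ {n} → Fin n → Fin n → Bool
neq x y = not ⌊ x ≟ y ⌋

nbr : ∀ {n} → Mat n → Fin n → Fin n → Bool
nbr A v w = neq v w ∧ A v w

localCompl : ∀ {n} → Mat n → Fin n → Mat n
localCompl A v x y = A x y xor (neq x y ∧ (nbr A v x ∧ nbr A v y))

pivot : ∀ {n} → Mat n → Fin n → Fin n → Mat n
pivot A v w = localCompl (localCompl (localCompl A v) w) v

data PivotStep {n} : Mat n → Mat n → Set where
  step : ∀ {A} v w → v ≢ w → A v w ≡ true → PivotStep A (pivot A v w)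

Pivots : ∀ {n} → Mat n → Mat n → Set
Pivots = Star PivotStep

GraphIso : ∀ {n m} → Mat n → Mat m → Set
GraphIso {n} {m} A B =
  Σ (Fin n ↔ Fin m) λ σ → ∀ i j → B (Inverse.to σ i) (Inverse.to σ j) ≡ A i j

PivotEquivalentUpToIso : ∀ {n m} → Mat n → Mat m → Set
PivotEquivalentUpToIso {n} A B = Σ (Mat n) λ C → Pivots A C × GraphIso C B

-- The binary matroid M(IAS(G)) represented by (I | A | I + A)

data Col : Set where
  φ χ ψ : Col

Ground : ℕ → Set
Ground n = Fin n × Col

column : ∀ {n} → Mat n → Ground n → Fin n → Bool
column A (v , φ) i = ⌊ i ≟ v ⌋
column A (v , χ) i = A i v
column A (v , ψ) i = ⌊ i ≟ v ⌋ xor A i v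

bigXor : ∀ {n} → (Fin n → Bool) → Bool
bigXor {zero} f = false
bigXor {suc n} f = f zero xor bigXor (λ i → f (suc i))

Subset : ℕ → Set
Subset n = Ground n → Bool

sumCols : ∀ {n} → Mat n → Subset n → Fin n → Bool
sumCols A T i =
  bigXor λ v →
    ((T (v , φ) ∧ column A (v , φ) i) xor (T (v , χ) ∧ column A (v , χ) i))
      xor (T (v , ψ) ∧ column A (v , ψ) i)

Dependent : ∀ {n} → Mat n → Subset n → Set
Dependent A S =
  Σ (Subset _) λ T →
    (∀ e → T e ≡ true → S e ≡ true) × (∃ λ e → T e ≡ true)
      × (∀ i → sumCols A T i ≡ false)

Independent : ∀ {n} → Mat n → Subset n → Set
Independent A S = ¬ Dependent A S

IsMatroidIso : ∀ {n m} → Mat n → Mat m → (Ground n ↔ Ground m) → Set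
IsMatroidIso A B β =
  ∀ (S : Subset _) →
    (Independent A S → Independent B (λ e → S (Inverse.from β e)))
    × (Independent B (λ e → S (Inverse.from β e)) → Independent A S)

-- compatible: each cell {v_φ, v_χ, v_ψ} is mapped into (hence, β being
-- a bijection, onto) a single cell
Compatible : ∀ {n m} → (Ground n ↔ Ground m) → Set
Compatible {n} {m} β = ∀ (v : Fin n) → ∃ λ (w : Fin m) →
  ∀ ι → proj₁ (Inverse.to β (v , ι)) ≡ w

fβ : ∀ {n m} → (Ground n ↔ Ground m) → Fin n → Col → Col
fβ β v ι = proj₂ (Inverse.to β (v , ι))

swapφψ : Col → Col
swapφψ φ = ψ
swapφψ χ = χ
swapφψ ψ = φ

swapφχ : Col → Col
swapφχ φ = χ
swapφχ χ = φ
swapφχ ψ = ψ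

InIdOrφψ : ∀ {n m} → (Ground n ↔ Ground m) → Fin n → Set
InIdOrφψ β v = (∀ ι → fβ β v ι ≡ ι) ⊎ (∀ ι → fβ β v ι ≡ swapφψ ι)

InIdOrφχ : ∀ {n m} → (Ground n ↔ Ground m) → Fin n → Set
InIdOrφχ β v = (∀ ι → fβ β v ι ≡ ι) ⊎ (∀ ι → fβ β v ι ≡ swapφχ ι)

GoodCompatibleIso : ∀ {n m} → Mat n → Mat m → Set
GoodCompatibleIso {n} {m} A B =
  Σ (Ground n ↔ Ground m) λ β →
    IsMatroidIso A B β × Compatible β
      × (∀ v → Looped A v → InIdOrφψ β v)
      × (∀ v → Unlooped A v → InIdOrφχ β v)

-- Represent M(IAS(G)) by the columns of (I | A | I + A) over GF(2) and call f_β(v) admissible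
-- when it is 1 or the transposition the loop status of v allows.
--
-- An edge pivot on vw is realised by an invertible linear map of GF(2)^n (swap coordinates v and
-- w, then add multiples of them to the other coordinates): it sends every column of A to a column
-- of A^vw, permuting the cells of v and w by the allowed transposition and fixing all other cells.
-- So pivots, like graph isomorphisms, induce compatible isomorphisms with admissible f.
--
-- Conversely, call v moved if f_β(v) ≠ 1. A moved vertex v has a moved neighbour w: otherwise
-- the cell of v that β sends to φ and the φ-cells of its neighbours form a dependent set
-- (the first column is the sum of the others) mapped into the independent φ-cells. Pivoting on vw
-- turns both back to 1 and changes nothing else, so induction on the set of moved vertices
-- reaches a β with f_β = 1 everywhere. Such a β is induced by a graph isomorphism, because
-- {u_φ : u ≠ i} ∪ {j_χ} is independent exactly when A_ij = 1.

module Submission where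

open import Defs
open import Algebra.Bundles using (CommutativeRing)
import Algebra.Properties.CommutativeMonoid.Sum as CommutativeMonoidSum
open import Data.Bool using (Bool; true; false; _xor_; _∧_; _∨_; not)
import Data.Bool as Bool
open import Data.Bool.Properties
  using ( T-∧; ⇔→≡; xor-∧-commutativeRing; ∧-comm; ∧-conicalˡ; ∧-conicalʳ; ∧-identityʳ
        ; xor-identityʳ; xor-comm; xor-same)
open import Data.Empty using (⊥-elim)
open import Data.Fin using (Fin; zero; suc; _≟_)
open import Data.Fin.Properties using (any?; suc-injective)
open import Data.Fin.Subset using (_⊂_; _∈_) renaming (Subset to VertexSet)
open import Data.Fin.Subset.Induction using (⊂-wellFounded)
open import Data.Fin.Subset.Properties using (nonempty?)
open import Data.Nat using (ℕ; zero; suc)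
open import Data.Product using (∃; _×_; _,_; proj₁; proj₂; map₁)
open import Data.Sum using (_⊎_; inj₁; inj₂)
open import Data.Vec using (tabulate)
open import Data.Vec.Functional using (Vector)
open import Data.Vec.Properties using (lookup∘tabulate; []=⇒lookup; lookup⇒[]=)
open import Function using (_∘_; id; _⇔_; mk⇔)
open import Function.Bundles using (Inverse; _↔_; mk↔ₛ′; Equivalence)
open import Function.Construct.Composition using (_↔-∘_)
open import Function.Construct.Symmetry using (↔-sym)
open import Induction.WellFounded using (Acc; acc)
open import Relation.Binary.Construct.Closure.ReflexiveTransitive using (ε; _◅_)
open import Relation.Binary.PropositionalEquality
open import Relation.Nullary using (Dec; yes; no; ¬?; _×-dec_; contradiction)
open import Relation.Nullary.Decidable using (⌊_⌋)

open Inverse using (to; from; strictlyInverseˡ; strictlyInverseʳ)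
open ≡-Reasoning

private
  variable
    n m : ℕ

BoolFn : ℕ → Set
BoolFn zero    = Bool
BoolFn (suc k) = Bool → BoolFn k

Agree : ∀ k → BoolFn k → BoolFn k → Set
Agree zero    a b = a ≡ b
Agree (suc k) f g = ∀ x → Agree k (f x) (g x)

agree? : ∀ k → BoolFn k → BoolFn k → Bool
agree? zero    a b = not (a xor b)
agree? (suc k) f g = agree? k (f true) (g true) ∧ agree? k (f false) (g false)

byTruthTable : ∀ k {f g : BoolFn k} {_ : Bool.T (agree? k f g)} → Agree k f g
byTruthTable zero    {false} {false} = refl
byTruthTable zero    {true}  {true}  = refl
byTruthTable (suc k) {_} {_} {h} true  = byTruthTable k {_} {_} {proj₁ (Equivalence.to T-∧ h)}
byTruthTable (suc k) {_} {_} {h} false = byTruthTable k {_} {_} {proj₂ (Equivalence.to T-∧ h)}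

≟-refl : (x : Fin n) → ⌊ x ≟ x ⌋ ≡ true
≟-refl x with x ≟ x
... | yes _   = refl
... | no x≢x = ⊥-elim (x≢x refl)

≟-≢ : {x y : Fin n} → x ≢ y → ⌊ x ≟ y ⌋ ≡ false
≟-≢ {x = x} {y} x≢y with x ≟ y
... | yes x≡y = ⊥-elim (x≢y x≡y)
... | no _    = refl

≟-sym : (x y : Fin n) → ⌊ x ≟ y ⌋ ≡ ⌊ y ≟ x ⌋
≟-sym x y with x ≟ y
... | yes refl = sym (≟-refl x)
... | no x≢y   = sym (≟-≢ (≢-sym x≢y))

≟-true : {x y : Fin n} → ⌊ x ≟ y ⌋ ≡ true → x ≡ y
≟-true {x = x} {y} eq with x ≟ y
... | yes x≡y = x≡y
... | no _    with () ← eq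

≟-inverse : (σ : Fin n ↔ Fin m) (y : Fin m) (x : Fin n) →
            ⌊ y ≟ to σ x ⌋ ≡ ⌊ from σ y ≟ x ⌋
≟-inverse σ y x with y ≟ to σ x | from σ y ≟ x
... | yes _   | yes _   = refl
... | no _    | no _    = refl
... | yes y≡x | no τy≢x = ⊥-elim (τy≢x (trans (cong (from σ) y≡x) (strictlyInverseʳ σ x)))
... | no y≢x  | yes τy≡x = ⊥-elim (y≢x (trans (sym (strictlyInverseˡ σ y)) (cong (to σ) τy≡x)))

bigXor-cong : {f g : Fin n → Bool} → (∀ x → f x ≡ g x) → bigXor f ≡ bigXor g
bigXor-cong {zero}  eq = refl
bigXor-cong {suc n} eq = cong₂ _xor_ (eq zero) (bigXor-cong (eq ∘ suc))

bigXor-xor : (f g : Fin n → Bool) → bigXor (λ x → f x xor g x) ≡ bigXor f xor bigXor g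
bigXor-xor {zero}  f g = refl
bigXor-xor {suc n} f g =
  trans (cong ((f zero xor g zero) xor_) (bigXor-xor (f ∘ suc) (g ∘ suc)))
        (interchange (f zero) (g zero) _ _)
  where
  interchange : ∀ a b c d → (a xor b) xor (c xor d) ≡ (a xor c) xor (b xor d)
  interchange = byTruthTable 4

bigXor-zero : (f : Fin n → Bool) → (∀ x → f x ≡ false) → bigXor f ≡ false
bigXor-zero {zero}  f z = refl
bigXor-zero {suc n} f z rewrite z zero = bigXor-zero (f ∘ suc) (z ∘ suc)

bigXor-single : (f : Fin n → Bool) (j : Fin n) → (∀ x → x ≢ j → f x ≡ false) → bigXor f ≡ f j
bigXor-single {suc n} f zero z =
  trans (cong (f zero xor_) (bigXor-zero (f ∘ suc) (λ x → z (suc x) λ ())))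
        (xor-identityʳ (f zero))
bigXor-single {suc n} f (suc j) z rewrite z zero (λ ()) =
  bigXor-single (f ∘ suc) j (λ x x≢j → z (suc x) (x≢j ∘ suc-injective))

bigXor-δ : (g : Fin n → Bool) (j : Fin n) → bigXor (λ x → ⌊ x ≟ j ⌋ ∧ g x) ≡ g j
bigXor-δ g j = trans (bigXor-single _ j λ x x≢j → cong (_∧ g x) (≟-≢ x≢j))
                     (cong (_∧ g j) (≟-refl j))

module ⊕-Sum = CommutativeMonoidSum (CommutativeRing.+-commutativeMonoid xor-∧-commutativeRing)

bigXor≡sum : (f : Fin n → Bool) → bigXor f ≡ ⊕-Sum.sum f
bigXor≡sum {zero}  f = refl
bigXor≡sum {suc n} f = cong (f zero xor_) (bigXor≡sum (f ∘ suc))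

bigXor-permute : (π : Fin m ↔ Fin n) (g : Fin n → Bool) → bigXor (g ∘ to π) ≡ bigXor g
bigXor-permute π g = begin
  bigXor (g ∘ to π)    ≡⟨ bigXor≡sum (g ∘ to π) ⟩
  ⊕-Sum.sum (g ∘ to π) ≡⟨ sym (⊕-Sum.sum-permute g π) ⟩
  ⊕-Sum.sum g          ≡⟨ sym (bigXor≡sum g) ⟩
  bigXor g             ∎

cellSum : (Col → Bool) → Bool
cellSum f = (f φ xor f χ) xor f ψ

cellSum-cong : {f g : Col → Bool} → (∀ ι → f ι ≡ g ι) → cellSum f ≡ cellSum g
cellSum-cong eq = cong₂ _xor_ (cong₂ _xor_ (eq φ) (eq χ)) (eq ψ)

sumCols-cong : (A : Mat n) {T T′ : Subset n} → (∀ e → T e ≡ T′ e) →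
               ∀ i → sumCols A T i ≡ sumCols A T′ i
sumCols-cong A eq i = bigXor-cong λ x → cellSum-cong λ ι → cong (_∧ column A (x , ι) i) (eq (x , ι))

sumCols-formula : (A : Mat n) (T : Subset n) (k : Fin n) →
  sumCols A T k ≡ (T (k , φ) xor T (k , ψ)) xor bigXor (λ x → (T (x , χ) xor T (x , ψ)) ∧ A k x)
sumCols-formula A T k = begin
  sumCols A T k
    ≡⟨ bigXor-cong (λ x → regroup (T (x , φ)) (T (x , χ)) (T (x , ψ)) ⌊ k ≟ x ⌋ (A k x)) ⟩
  bigXor (λ x → (⌊ k ≟ x ⌋ ∧ φψ-part x) xor χψ-part x)
    ≡⟨ bigXor-xor (λ x → ⌊ k ≟ x ⌋ ∧ φψ-part x) χψ-part ⟩
  bigXor (λ x → ⌊ k ≟ x ⌋ ∧ φψ-part x) xor bigXor χψ-part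
    ≡⟨ cong (_xor bigXor χψ-part) (bigXor-cong λ x → cong (_∧ φψ-part x) (≟-sym k x)) ⟩
  bigXor (λ x → ⌊ x ≟ k ⌋ ∧ φψ-part x) xor bigXor χψ-part
    ≡⟨ cong (_xor bigXor χψ-part) (bigXor-δ φψ-part k) ⟩
  (T (k , φ) xor T (k , ψ)) xor bigXor (λ x → (T (x , χ) xor T (x , ψ)) ∧ A k x) ∎
  where
  φψ-part χψ-part : Fin _ → Bool
  φψ-part x = T (x , φ) xor T (x , ψ)
  χψ-part x = (T (x , χ) xor T (x , ψ)) ∧ A k x
  regroup : ∀ a b c d e →
    ((a ∧ d) xor (b ∧ e)) xor (c ∧ (d xor e)) ≡ (d ∧ (a xor c)) xor ((b xor c) ∧ e)
  regroup = byTruthTable 5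

⊆-false : {S T : Subset n} → (∀ e → T e ≡ true → S e ≡ true) → ∀ e → S e ≡ false → T e ≡ false
⊆-false {T = T} T⊆S e Se with T e in Te
... | false = refl
... | true  with () ← trans (sym Se) (T⊆S e Te)

dependent-mono : (A : Mat n) {S S′ : Subset n} → (∀ e → S e ≡ true → S′ e ≡ true) →
                 Dependent A S → Dependent A S′
dependent-mono A S⊆S′ (T , T⊆S , nonempty , zero-sum) = T , (λ e → S⊆S′ e ∘ T⊆S e) , nonempty , zero-sum

independent-cong : (A : Mat n) {S S′ : Subset n} → (∀ e → S e ≡ S′ e) →
                   Independent A S → Independent A S′
independent-cong A eq indep = indep ∘ dependent-mono A (λ e S′e → trans (eq e) S′e)

isφ : Col → Bool
isφ φ = true
isφ χ = false
isφ ψ = false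

independent-φ : (A : Mat n) → Independent A (λ e → isφ (proj₂ e))
independent-φ A (T , T⊆φ , (e , Te) , zero-sum) = contradiction (trans (sym Te) (T-empty e)) λ ()
  where
  Tχ : ∀ y → T (y , χ) ≡ false
  Tχ y = ⊆-false T⊆φ (y , χ) refl
  Tψ : ∀ y → T (y , ψ) ≡ false
  Tψ y = ⊆-false T⊆φ (y , ψ) refl
  Tφ : ∀ k → T (k , φ) ≡ false
  Tφ k = begin
    T (k , φ)                          ≡⟨ sym (xor-identityʳ _) ⟩
    T (k , φ) xor false                ≡⟨ sym (xor-identityʳ _) ⟩
    (T (k , φ) xor false) xor false    ≡⟨ cong₂ (λ a b → (T (k , φ) xor a) xor b) (sym (Tψ k)) (sym no-χψ) ⟩
    (T (k , φ) xor T (k , ψ)) xor bigXor (λ y → (T (y , χ) xor T (y , ψ)) ∧ A k y)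
                                       ≡⟨ sym (sumCols-formula A T k) ⟩
    sumCols A T k                      ≡⟨ zero-sum k ⟩
    false                              ∎
    where
    no-χψ : bigXor (λ y → (T (y , χ) xor T (y , ψ)) ∧ A k y) ≡ false
    no-χψ = bigXor-zero _ λ y → cong₂ (λ a b → (a xor b) ∧ A k y) (Tχ y) (Tψ y)
  T-empty : ∀ e → T e ≡ false
  T-empty (y , φ) = Tφ y
  T-empty (y , χ) = Tχ y
  T-empty (y , ψ) = Tψ y

basisExchange : Fin n → Fin n → Subset n
basisExchange i j (u , φ) = not ⌊ u ≟ i ⌋
basisExchange i j (u , χ) = ⌊ u ≟ j ⌋
basisExchange i j (u , ψ) = false

basisExchange-dependent : (A : Mat n) (i j : Fin n) → A i j ≡ false → Dependent A (basisExchange i j)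
basisExchange-dependent A i j Aij≡false = T , T⊆ , ((j , χ) , ≟-refl j) , zero-sum
  where
  T : Subset _
  T (u , φ) = not ⌊ u ≟ i ⌋ ∧ A u j
  T (u , χ) = ⌊ u ≟ j ⌋
  T (u , ψ) = false
  T⊆ : ∀ e → T e ≡ true → basisExchange i j e ≡ true
  T⊆ (u , φ) Te = ∧-conicalˡ _ _ Te
  T⊆ (u , χ) Te = Te
  cancel : (k : Fin _) → Dec (k ≡ i) → ((not ⌊ k ≟ i ⌋ ∧ A k j) xor false) xor A k j ≡ false
  cancel k (yes refl) rewrite ≟-refl k = Aij≡false
  cancel k (no k≢i) rewrite ≟-≢ k≢i = cancel′ (A k j)
    where
    cancel′ : ∀ a → (a xor false) xor a ≡ false
    cancel′ = byTruthTable 1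
  zero-sum : ∀ k → sumCols A T k ≡ false
  zero-sum k = begin
    sumCols A T k
      ≡⟨ sumCols-formula A T k ⟩
    (T (k , φ) xor false) xor bigXor (λ x → (⌊ x ≟ j ⌋ xor false) ∧ A k x)
      ≡⟨ cong ((T (k , φ) xor false) xor_)
              (trans (bigXor-cong λ x → cong (_∧ A k x) (xor-identityʳ _)) (bigXor-δ (A k) j)) ⟩
    (T (k , φ) xor false) xor A k j
      ≡⟨ cancel k (k ≟ i) ⟩
    false ∎

sumCols-⊆basisExchange : (A : Mat n) (i j : Fin n) {T : Subset n} →
  (∀ e → T e ≡ true → basisExchange i j e ≡ true) → ∀ k → sumCols A T k ≡ T (k , φ) xor (T (j , χ) ∧ A k j)
sumCols-⊆basisExchange A i j {T} T⊆ k = begin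
  sumCols A T k
    ≡⟨ sumCols-formula A T k ⟩
  (T (k , φ) xor T (k , ψ)) xor bigXor χψ-part
    ≡⟨ cong₂ (λ a b → (T (k , φ) xor a) xor b) (Tψ k) (bigXor-single χψ-part j off-j) ⟩
  (T (k , φ) xor false) xor ((T (j , χ) xor T (j , ψ)) ∧ A k j)
    ≡⟨ cong₂ (λ a b → a xor (b ∧ A k j)) (xor-identityʳ (T (k , φ)))
             (trans (cong (T (j , χ) xor_) (Tψ j)) (xor-identityʳ (T (j , χ)))) ⟩
  T (k , φ) xor (T (j , χ) ∧ A k j) ∎
  where
  Tψ : ∀ y → T (y , ψ) ≡ false
  Tψ y = ⊆-false T⊆ (y , ψ) refl
  χψ-part : Fin _ → Bool
  χψ-part x = (T (x , χ) xor T (x , ψ)) ∧ A k x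
  off-j : ∀ x → x ≢ j → χψ-part x ≡ false
  off-j x x≢j rewrite ⊆-false T⊆ (x , χ) (≟-≢ x≢j) | Tψ x = refl

dependent-basisExchange : (A : Mat n) (i j : Fin n) → Dependent A (basisExchange i j) → A i j ≡ false
dependent-basisExchange A i j (T , T⊆ , (e , Te) , zero-sum) with A i j in Aij
... | false = refl
... | true  = contradiction (trans (sym Te) (T-empty e)) λ ()
  where
  sum-at : ∀ k → T (k , φ) xor (T (j , χ) ∧ A k j) ≡ false
  sum-at k = trans (sym (sumCols-⊆basisExchange A i j T⊆ k)) (zero-sum k)
  Tjχ : T (j , χ) ≡ false
  Tjχ = begin
    T (j , χ)                         ≡⟨ sym (∧-identityʳ _) ⟩
    T (j , χ) ∧ true                  ≡⟨ cong (T (j , χ) ∧_) (sym Aij) ⟩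
    T (j , χ) ∧ A i j                 ≡⟨ cong (_xor (T (j , χ) ∧ A i j)) (sym Tiφ) ⟩
    T (i , φ) xor (T (j , χ) ∧ A i j) ≡⟨ sum-at i ⟩
    false                             ∎
    where
    Tiφ : T (i , φ) ≡ false
    Tiφ = ⊆-false T⊆ (i , φ) (cong not (≟-refl i))
  Tφ : ∀ k → T (k , φ) ≡ false
  Tφ k = begin
    T (k , φ)                         ≡⟨ sym (xor-identityʳ _) ⟩
    T (k , φ) xor false               ≡⟨ cong (λ b → T (k , φ) xor (b ∧ A k j)) (sym Tjχ) ⟩
    T (k , φ) xor (T (j , χ) ∧ A k j) ≡⟨ sum-at k ⟩
    false                             ∎
  T-empty : ∀ e → T e ≡ false
  T-empty (y , φ) = Tφ y
  T-empty (y , χ) with y ≟ j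
  ... | yes refl = Tjχ
  ... | no y≢j   = ⊆-false T⊆ (y , χ) (≟-≢ y≢j)
  T-empty (y , ψ) = ⊆-false T⊆ (y , ψ) refl

independent-basisExchange : (A : Mat n) (i j : Fin n) → Independent A (basisExchange i j) ⇔ A i j ≡ true
independent-basisExchange A i j = mk⇔ entry-true independent
  where
  entry-true : Independent A (basisExchange i j) → A i j ≡ true
  entry-true indep with A i j in Aij
  ... | true  = refl
  ... | false = ⊥-elim (indep (basisExchange-dependent A i j Aij))
  independent : A i j ≡ true → Independent A (basisExchange i j)
  independent Aij dep = contradiction (trans (sym Aij) (dependent-basisExchange A i j dep)) λ ()

-- The χ-cell (if v is unlooped) or ψ-cell (if looped) of v, whose column is the sum of the unit
-- columns of v's neighbours, together with the φ-cells of those neighbours.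
neighbourCells : Mat n → Fin n → Subset n
neighbourCells A v (x , φ) = not ⌊ x ≟ v ⌋ ∧ A x v
neighbourCells A v (x , χ) = ⌊ x ≟ v ⌋ ∧ not (A v v)
neighbourCells A v (x , ψ) = ⌊ x ≟ v ⌋ ∧ A v v

neighbourCells-dependent : (A : Mat n) (v : Fin n) → Dependent A (neighbourCells A v)
neighbourCells-dependent A v = N , (λ _ Ne → Ne) , nonempty , zero-sum
  where
  N : Subset _
  N = neighbourCells A v
  nonempty : ∃ λ e → N e ≡ true
  nonempty with A v v in Avv
  ... | true  = (v , ψ) , trans (cong (_∧ A v v) (≟-refl v)) Avv
  ... | false = (v , χ) , trans (cong (_∧ not (A v v)) (≟-refl v)) (cong not Avv)
  cancel : (k : Fin _) → Dec (k ≡ v) →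
           ((not ⌊ k ≟ v ⌋ ∧ A k v) xor (⌊ k ≟ v ⌋ ∧ A v v)) xor A k v ≡ false
  cancel k (yes refl) rewrite ≟-refl k = xor-same (A k k)
  cancel k (no k≢v) rewrite ≟-≢ k≢v = cancel′ (A k v)
    where
    cancel′ : ∀ a → (a xor false) xor a ≡ false
    cancel′ = byTruthTable 1
  zero-sum : ∀ k → sumCols A N k ≡ false
  zero-sum k = begin
    sumCols A N k
      ≡⟨ sumCols-formula A N k ⟩
    (N (k , φ) xor N (k , ψ)) xor bigXor (λ x → (N (x , χ) xor N (x , ψ)) ∧ A k x)
      ≡⟨ cong ((N (k , φ) xor N (k , ψ)) xor_)
              (trans (bigXor-cong λ x → cong (_∧ A k x) (merge ⌊ x ≟ v ⌋ (A v v))) (bigXor-δ (A k) v)) ⟩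
    (N (k , φ) xor N (k , ψ)) xor A k v
      ≡⟨ cancel k (k ≟ v) ⟩
    false ∎
    where
    merge : ∀ d b → (d ∧ not b) xor (d ∧ b) ≡ d
    merge = byTruthTable 2

loopSwap : Bool → Col → Col
loopSwap true  = swapφψ
loopSwap false = swapφχ

loopSwap-involutive : ∀ b ι → loopSwap b (loopSwap b ι) ≡ ι
loopSwap-involutive true  φ = refl
loopSwap-involutive true  χ = refl
loopSwap-involutive true  ψ = refl
loopSwap-involutive false φ = refl
loopSwap-involutive false χ = refl
loopSwap-involutive false ψ = refl

data Admissible (b : Bool) (f : Col → Col) : Set where
  keeps : (∀ ι → f ι ≡ ι) → Admissible b f
  swaps : (∀ ι → f ι ≡ loopSwap b ι) → Admissible b f

admissible⇒⊎ : ∀ {b f} → Admissible b f → (∀ ι → f ι ≡ ι) ⊎ (∀ ι → f ι ≡ loopSwap b ι)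
admissible⇒⊎ (keeps f≗id) = inj₁ f≗id
admissible⇒⊎ (swaps f≗s)  = inj₂ f≗s

⊎⇒admissible : ∀ {b f} → (∀ ι → f ι ≡ ι) ⊎ (∀ ι → f ι ≡ loopSwap b ι) → Admissible b f
⊎⇒admissible (inj₁ f≗id) = keeps f≗id
⊎⇒admissible (inj₂ f≗s)  = swaps f≗s

admissible-cong : ∀ {b f g} → (∀ ι → f ι ≡ g ι) → Admissible b g → Admissible b f
admissible-cong f≗g (keeps g≗id)   = keeps λ ι → trans (f≗g ι) (g≗id ι)
admissible-cong f≗g (swaps g≗s)    = swaps λ ι → trans (f≗g ι) (g≗s ι)

admissible-∘ : ∀ {b f g} → Admissible b f → Admissible b g → Admissible b (f ∘ g)
admissible-∘     (keeps f≗id) (keeps g≗id) = keeps λ ι → trans (f≗id _) (g≗id ι)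
admissible-∘     (keeps f≗id) (swaps g≗s)  = swaps λ ι → trans (f≗id _) (g≗s ι)
admissible-∘ {b} (swaps f≗s)  (keeps g≗id) = swaps λ ι → trans (f≗s _) (cong (loopSwap b) (g≗id ι))
admissible-∘ {b} (swaps f≗s)  (swaps g≗s)  =
  keeps λ ι → trans (f≗s _) (trans (cong (loopSwap b) (g≗s ι)) (loopSwap-involutive b ι))

admissible-involutive : ∀ {b f} → Admissible b f → ∀ ι → f (f ι) ≡ ι
admissible-involutive         (keeps f≗id) ι = trans (f≗id _) (f≗id ι)
admissible-involutive {b} {f} (swaps f≗s)  ι =
  trans (f≗s (f ι)) (trans (cong (loopSwap b) (f≗s ι)) (loopSwap-involutive b ι))

cellSum-loopSwap : ∀ b (g : Col → Bool) → cellSum (g ∘ loopSwap b) ≡ cellSum g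
cellSum-loopSwap true  g = reverse (g φ) (g χ) (g ψ)
  where
  reverse : ∀ a b c → (c xor b) xor a ≡ (a xor b) xor c
  reverse = byTruthTable 3
cellSum-loopSwap false g = cong (_xor g ψ) (xor-comm (g χ) (g φ))

cellSum-admissible : ∀ {b s} → Admissible b s → (g : Col → Bool) → cellSum (g ∘ s) ≡ cellSum g
cellSum-admissible         (keeps s≗id) g = cellSum-cong (cong g ∘ s≗id)
cellSum-admissible {b = b} (swaps s≗s)  g = trans (cellSum-cong (cong g ∘ s≗s)) (cellSum-loopSwap b g)

column-admissible-ψ : ∀ {b s} → Admissible b s → (M : Mat n) (x i : Fin n) →
                      column M (x , s φ) i xor column M (x , s χ) i ≡ column M (x , s ψ) i
column-admissible-ψ (keeps s≗id) M x i rewrite s≗id φ | s≗id χ | s≗id ψ = refl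
column-admissible-ψ {b = true}  (swaps s≗s) M x i rewrite s≗s φ | s≗s χ | s≗s ψ =
  cancel ⌊ i ≟ x ⌋ (M i x)
  where
  cancel : ∀ d a → (d xor a) xor a ≡ d
  cancel = byTruthTable 2
column-admissible-ψ {b = false} (swaps s≗s) M x i rewrite s≗s φ | s≗s χ | s≗s ψ =
  xor-comm (M i x) ⌊ i ≟ x ⌋

column-loopSwap-φ : (M : Mat n) {x : Fin n} {b : Bool} → M x x ≡ b →
                    ∀ i → column M (x , loopSwap b φ) i ≡ not ⌊ i ≟ x ⌋ ∧ M i x
column-loopSwap-φ M {x} {b} Mxx i with i ≟ x | b
... | yes refl | true  rewrite ≟-refl i | Mxx = refl
... | yes refl | false = Mxx
... | no i≢x   | true  rewrite ≟-≢ i≢x = refl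
... | no i≢x   | false = refl

column-loopSwap-χ : (M : Mat n) {x : Fin n} {b : Bool} → M x x ≡ b →
                    ∀ i → column M (x , loopSwap b χ) i ≡ ⌊ i ≟ x ⌋ ∨ (b ∧ M i x)
column-loopSwap-χ M {x} {b} Mxx i with i ≟ x | b
... | yes refl | true  = Mxx
... | yes refl | false rewrite ≟-refl i = refl
... | no i≢x   | true  = refl
... | no i≢x   | false rewrite ≟-≢ i≢x = refl

movesφ : (Col → Col) → Bool
movesφ f = not (isφ (f φ))

admissible-fixing : ∀ {b f} → Admissible b f → movesφ f ≡ false → ∀ ι → f ι ≡ ι
admissible-fixing         (keeps f≗id) _     = f≗id
admissible-fixing {true}  (swaps f≗s)  fixes with () ← trans (sym (cong (not ∘ isφ) (f≗s φ))) fixes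
admissible-fixing {false} (swaps f≗s)  fixes with () ← trans (sym (cong (not ∘ isφ) (f≗s φ))) fixes

admissible-moving : ∀ {b f} → Admissible b f → movesφ f ≡ true → ∀ ι → f ι ≡ loopSwap b ι
admissible-moving (keeps f≗id) moves with () ← trans (sym (cong (not ∘ isφ) (f≗id φ))) moves
admissible-moving (swaps f≗s)  _     = f≗s

isφ-loopSwap-χ : ∀ b → isφ (loopSwap b χ) ≡ not b
isφ-loopSwap-χ true  = refl
isφ-loopSwap-χ false = refl

isφ-loopSwap-ψ : ∀ b → isφ (loopSwap b ψ) ≡ b
isφ-loopSwap-ψ true  = refl
isφ-loopSwap-ψ false = refl

-- Matroid isomorphisms induced by linear maps

IsZero : Vector Bool n → Set
IsZero u = ∀ i → u i ≡ false

module _ {A : Mat n} {B : Mat m} (β : Ground n ↔ Ground m) (L : Vector Bool n → Vector Bool m)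
         (L-zero : ∀ {u} → IsZero u → IsZero (L u)) (L-injective : ∀ {u} → IsZero (L u) → IsZero u)
         (sumCols-β : ∀ T j → sumCols B (T ∘ from β) j ≡ L (sumCols A T) j) where

  dependent-image : ∀ {S} → Dependent A S → Dependent B (S ∘ from β)
  dependent-image (T , T⊆S , (e , Te) , zero-sum) =
    T ∘ from β , (λ e → T⊆S (from β e)) , (to β e , trans (cong T (strictlyInverseʳ β e)) Te) ,
    λ j → trans (sumCols-β T j) (L-zero zero-sum j)

  dependent-preimage : ∀ {S} → Dependent B (S ∘ from β) → Dependent A S
  dependent-preimage {S} (T , T⊆S , (e , Te) , zero-sum) =
    T ∘ to β , T⊆Sβ , (from β e , trans (cong T (strictlyInverseˡ β e)) Te) , L-injective image-zero
    where
    T⊆Sβ : ∀ e → T (to β e) ≡ true → S e ≡ true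
    T⊆Sβ e Te = trans (cong S (sym (strictlyInverseʳ β e))) (T⊆S (to β e) Te)
    image-zero : IsZero (L (sumCols A (T ∘ to β)))
    image-zero j = begin
      L (sumCols A (T ∘ to β)) j       ≡⟨ sym (sumCols-β (T ∘ to β) j) ⟩
      sumCols B (T ∘ to β ∘ from β) j  ≡⟨ sumCols-cong B (cong T ∘ strictlyInverseˡ β) j ⟩
      sumCols B T j                    ≡⟨ zero-sum j ⟩
      false                            ∎

  isMatroidIso-byLinearMap : IsMatroidIso A B β
  isMatroidIso-byLinearMap S = (λ indep → indep ∘ dependent-preimage) , (λ indep → indep ∘ dependent-image)

isMatroidIso-∘ : {k : ℕ} {A : Mat n} {B : Mat m} {C : Mat k}
                 {β : Ground n ↔ Ground m} {δ : Ground m ↔ Ground k} →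
                 IsMatroidIso B C δ → IsMatroidIso A B β → IsMatroidIso A C (δ ↔-∘ β)
isMatroidIso-∘ {β = β} iδ iβ S =
  proj₁ (iδ (S ∘ from β)) ∘ proj₁ (iβ S) , proj₂ (iβ S) ∘ proj₂ (iδ (S ∘ from β))

isMatroidIso-sym : {A : Mat n} {B : Mat m} {β : Ground n ↔ Ground m} →
                   IsMatroidIso A B β → IsMatroidIso B A (↔-sym β)
isMatroidIso-sym {A = A} {B} {β} iβ S =
  (λ indep → proj₂ (iβ (S ∘ to β)) (independent-cong B (cong S ∘ sym ∘ strictlyInverseˡ β) indep)) ,
  (λ indep → independent-cong B (cong S ∘ strictlyInverseˡ β) (proj₁ (iβ (S ∘ to β)) indep))

module LinearMap (L : Vector Bool n → Vector Bool m)
                 (L-xor : ∀ u u′ i → L (λ j → u j xor u′ j) i ≡ L u i xor L u′ i)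
                 (L-∧ : ∀ t u i → L (λ j → t ∧ u j) i ≡ t ∧ L u i) where

  L-bigXor : ∀ {k} (c : Fin k → Vector Bool n) i →
             L (λ j → bigXor (λ x → c x j)) i ≡ bigXor (λ x → L (c x) i)
  L-bigXor {zero}  c i = L-∧ false (λ _ → false) i
  L-bigXor {suc k} c i = trans (L-xor (c zero) (λ j → bigXor (λ x → c (suc x) j)) i)
                               (cong (L (c zero) i xor_) (L-bigXor (c ∘ suc) i))

  L-cellSum : (t : Col → Bool) (c : Col → Vector Bool n) (i : Fin m) →
              L (λ j → cellSum (λ ι → t ι ∧ c ι j)) i ≡ cellSum (λ ι → t ι ∧ L (c ι) i)
  L-cellSum t c i =
    trans (L-xor (λ j → (t φ ∧ c φ j) xor (t χ ∧ c χ j)) (λ j → t ψ ∧ c ψ j) i)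
          (cong₂ _xor_ (trans (L-xor (λ j → t φ ∧ c φ j) (λ j → t χ ∧ c χ j) i)
                              (cong₂ _xor_ (L-∧ (t φ) (c φ) i) (L-∧ (t χ) (c χ) i)))
                       (L-∧ (t ψ) (c ψ) i))

  L-sumCols : (A : Mat n) (T : Subset n) (i : Fin m) →
              L (sumCols A T) i ≡ bigXor (λ x → cellSum (λ ι → T (x , ι) ∧ L (column A (x , ι)) i))
  L-sumCols A T i = trans (L-bigXor (λ x j → cellSum (λ ι → T (x , ι) ∧ column A (x , ι) j)) i)
                          (bigXor-cong λ x → L-cellSum (λ ι → T (x , ι)) (λ ι → column A (x , ι)) i)

  L-column-ψ : {M : Mat n} {M′ : Mat m} {b : Bool} {s : Col → Col} → Admissible b s → ∀ x x′ →
               (∀ i → L (column M (x , φ)) i ≡ column M′ (x′ , s φ) i) →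
               (∀ i → L (column M (x , χ)) i ≡ column M′ (x′ , s χ) i) →
               ∀ i → L (column M (x , ψ)) i ≡ column M′ (x′ , s ψ) i
  L-column-ψ {M = M} {M′} s-adm x x′ Lφ Lχ i =
    trans (L-xor (column M (x , φ)) (column M (x , χ)) i)
          (trans (cong₂ _xor_ (Lφ i) (Lχ i)) (column-admissible-ψ s-adm M′ x′ i))

record Good (A : Mat n) (B : Mat m) (β : Ground n ↔ Ground m) : Set where
  constructor mkGood
  field
    isMatroidIso : IsMatroidIso A B β
    compatible   : Compatible β
    admissible   : ∀ v → Admissible (A v v) (fβ β v)

good⇒goodCompatibleIso : {A : Mat n} {B : Mat m} {β : Ground n ↔ Ground m} →
                         Good A B β → GoodCompatibleIso A B
good⇒goodCompatibleIso {A = A} {β = β} (mkGood iso compat adm) =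
  β , iso , compat , (λ v loop → admissibleAt v loop) , (λ v noLoop → admissibleAt v noLoop)
  where
  admissibleAt : ∀ v {b} → A v v ≡ b → (∀ ι → fβ β v ι ≡ ι) ⊎ (∀ ι → fβ β v ι ≡ loopSwap b ι)
  admissibleAt v Avv = admissible⇒⊎ (subst (λ b → Admissible b (fβ β v)) Avv (adm v))

goodCompatibleIso⇒good : {A : Mat n} {B : Mat m} (G : GoodCompatibleIso A B) → Good A B (proj₁ G)
goodCompatibleIso⇒good {A = A} (β , iso , compat , looped , unlooped) = mkGood iso compat adm
  where
  adm : ∀ v → Admissible (A v v) (fβ β v)
  adm v with A v v in Avv
  ... | true  = ⊎⇒admissible (looped v Avv)
  ... | false = ⊎⇒admissible (unlooped v Avv)

good-∘-cellwise : {A C : Mat n} {B : Mat m} {γ : Ground n ↔ Ground n} {X : Ground n ↔ Ground m}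
  (s : Fin n → Col → Col) → (∀ x ι → to γ (x , ι) ≡ (x , s x ι)) →
  IsMatroidIso A C γ → (∀ x → Admissible (A x x) (s x)) → (∀ x → C x x ≡ A x x) →
  Good C B X → Good A B (X ↔-∘ γ)
good-∘-cellwise {A = A} {C} {B} {γ} {X} s γ-cellwise iγ s-adm loops (mkGood iX cX X-adm) =
  mkGood (isMatroidIso-∘ {A = A} {C} {B} {γ} {X} iX iγ) compat adm
  where
  compat : Compatible (X ↔-∘ γ)
  compat x = proj₁ (cX x) , λ ι → trans (cong (proj₁ ∘ to X) (γ-cellwise x ι)) (proj₂ (cX x) (s x ι))
  adm : ∀ x → Admissible (A x x) (fβ (X ↔-∘ γ) x)
  adm x = admissible-cong (cong (proj₂ ∘ to X) ∘ γ-cellwise x)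
            (admissible-∘ (subst (λ b → Admissible b (fβ X x)) (loops x) (X-adm x)) (s-adm x))

-- Edge pivots

localCompl-diag : (M : Mat n) (v x : Fin n) → localCompl M v x x ≡ M x x
localCompl-diag M v x rewrite ≟-refl x = xor-identityʳ (M x x)

pivot-diag : (A : Mat n) (v w x : Fin n) → pivot A v w x x ≡ A x x
pivot-diag A v w x =
  trans (localCompl-diag (localCompl (localCompl A v) w) v x)
        (trans (localCompl-diag (localCompl A v) w x) (localCompl-diag A v x))

localCompl-symmetric : {M : Mat n} → Symmetric M → ∀ v → Symmetric (localCompl M v)
localCompl-symmetric {M = M} symM v x y =
  cong₂ _xor_ (symM x y) (cong₂ _∧_ (cong not (≟-sym x y)) (∧-comm (nbr M v x) (nbr M v y)))

pivot-symmetric : {A : Mat n} → Symmetric A → ∀ v w → Symmetric (pivot A v w)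
pivot-symmetric {A = A} symA v w =
  localCompl-symmetric {M = localCompl (localCompl A v) w} (localCompl-symmetric (localCompl-symmetric symA v) w) v

-- pivot A v w x y as a Boolean expression in the comparisons and entries it inspects, so that
-- identities between entries become truth-table checks.
pivotExpr : (x≟y w≟x w≟y v≟x w≟v v≟y v≟w v≟v axy avx avy awx awy avw awv avv : Bool) → Bool
pivotExpr x≟y w≟x w≟y v≟x w≟v v≟y v≟w v≟v axy avx avy awx awy avw awv avv =
  let nvx = not v≟x ∧ avx ; nvy = not v≟y ∧ avy ; nvw = not v≟w ∧ avw ; nvv = not v≟v ∧ avv
      a₁xy = axy xor (not x≟y ∧ (nvx ∧ nvy))
      a₁wx = awx xor (not w≟x ∧ (nvw ∧ nvx))
      a₁wy = awy xor (not w≟y ∧ (nvw ∧ nvy))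
      a₁vx = avx xor (not v≟x ∧ (nvv ∧ nvx))
      a₁wv = awv xor (not w≟v ∧ (nvw ∧ nvv))
      a₁vy = avy xor (not v≟y ∧ (nvv ∧ nvy))
      mwx = not w≟x ∧ a₁wx ; mwy = not w≟y ∧ a₁wy ; mwv = not w≟v ∧ a₁wv
      a₂xy = a₁xy xor (not x≟y ∧ (mwx ∧ mwy))
      a₂vx = a₁vx xor (not v≟x ∧ (mwv ∧ mwx))
      a₂vy = a₁vy xor (not v≟y ∧ (mwv ∧ mwy))
  in a₂xy xor (not x≟y ∧ ((not v≟x ∧ a₂vx) ∧ (not v≟y ∧ a₂vy)))

pivot-unfold : (A : Mat n) (v w x y : Fin n) →
  pivot A v w x y ≡ pivotExpr ⌊ x ≟ y ⌋ ⌊ w ≟ x ⌋ ⌊ w ≟ y ⌋ ⌊ v ≟ x ⌋ ⌊ w ≟ v ⌋ ⌊ v ≟ y ⌋ ⌊ v ≟ w ⌋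
                              ⌊ v ≟ v ⌋ (A x y) (A v x) (A v y) (A w x) (A w y) (A v w) (A w v) (A v v)
pivot-unfold A v w x y = refl

module Pivot {A : Mat n} (symA : Symmetric A) {v w : Fin n} (v≢w : v ≢ w) (Avw : A v w ≡ true) where

  Aᵛʷ : Mat n
  Aᵛʷ = pivot A v w

  private
    w≢v : w ≢ v
    w≢v = ≢-sym v≢w

    Awv : A w v ≡ true
    Awv = trans (symA w v) Avw

  pivot-vw : Aᵛʷ v w ≡ true
  pivot-vw rewrite pivot-unfold A v w v w | ≟-≢ v≢w | ≟-≢ w≢v | ≟-refl w | ≟-refl v | Avw | Awv =
    identity (A v v) (A w w)
    where
    identity : ∀ a b →
      pivotExpr false false true true false false false true true a true true b true true a ≡ true
    identity = byTruthTable 2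

  pivot-row-v : ∀ {y} → y ≢ v → y ≢ w → Aᵛʷ v y ≡ A w y
  pivot-row-v {y} y≢v y≢w
    rewrite pivot-unfold A v w v y | ≟-≢ (≢-sym y≢v) | ≟-≢ w≢v | ≟-≢ (≢-sym y≢w)
          | ≟-refl v | ≟-≢ v≢w | Avw | Awv =
    identity (A v y) (A v v) (A w y)
    where
    identity : ∀ a b c →
      pivotExpr false false false true false false false true a b a true c true true b ≡ c
    identity = byTruthTable 3

  pivot-row-w : ∀ {y} → y ≢ v → y ≢ w → Aᵛʷ w y ≡ A v y
  pivot-row-w {y} y≢v y≢w
    rewrite pivot-unfold A v w w y | ≟-≢ (≢-sym y≢w) | ≟-refl w | ≟-≢ v≢w | ≟-≢ w≢v
          | ≟-≢ (≢-sym y≢v) | ≟-refl v | Avw | Awv =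
    identity (A w y) (A v y) (A w w) (A v v)
    where
    identity : ∀ a b c d →
      pivotExpr false true false false false false false true a true b c a true true d ≡ b
    identity = byTruthTable 4

  -- On the diagonal the two added terms cancel.
  pivot-outside : ∀ {x y} → x ≢ v → x ≢ w → y ≢ v → y ≢ w →
                  Aᵛʷ x y ≡ A x y xor ((A v y ∧ A w x) xor (A w y ∧ A v x))
  pivot-outside {x} {y} x≢v x≢w y≢v y≢w = by-cases (x ≟ y)
    where
    by-cases : Dec (x ≡ y) → Aᵛʷ x y ≡ A x y xor ((A v y ∧ A w x) xor (A w y ∧ A v x))
    by-cases (yes refl) = trans (pivot-diag A v w x) (sym (cancel (A x x) (A v x) (A w x)))
      where
      cancel : ∀ a b c → a xor ((b ∧ c) xor (c ∧ b)) ≡ a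
      cancel = byTruthTable 3
    by-cases (no x≢y)
      rewrite pivot-unfold A v w x y | ≟-≢ x≢y | ≟-≢ (≢-sym x≢w) | ≟-≢ (≢-sym y≢w)
            | ≟-≢ (≢-sym x≢v) | ≟-≢ w≢v | ≟-≢ (≢-sym y≢v) | ≟-≢ v≢w | ≟-refl v | Avw | Awv =
      identity (A x y) (A v x) (A v y) (A w x) (A w y) (A v v)
      where
      identity : ∀ a b c d e f →
        pivotExpr false false false false false false false true a b c d e true true f ≡ a xor ((c ∧ d) xor (e ∧ b))
      identity = byTruthTable 6

  symAᵛʷ : Symmetric Aᵛʷ
  symAᵛʷ = pivot-symmetric symA v w

  pivot-wv : Aᵛʷ w v ≡ true
  pivot-wv = trans (symAᵛʷ w v) pivot-vw

  pivot-col-v : ∀ {y} → y ≢ v → y ≢ w → Aᵛʷ y v ≡ A w y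
  pivot-col-v y≢v y≢w = trans (symAᵛʷ _ v) (pivot-row-v y≢v y≢w)

  pivot-col-w : ∀ {y} → y ≢ v → y ≢ w → Aᵛʷ y w ≡ A v y
  pivot-col-w y≢v y≢w = trans (symAᵛʷ _ w) (pivot-row-w y≢v y≢w)

  -- Column sums of Aᵛʷ are the images of those of A under this invertible linear map.
  pivotMap : Vector Bool n → Vector Bool n
  pivotMap u i with i ≟ v | i ≟ w
  ... | yes _ | _     = u w
  ... | no _  | yes _ = u v
  ... | no _  | no _  = u i xor ((u v ∧ A w i) xor (u w ∧ A v i))

  pivotMap-xor : ∀ u u′ i → pivotMap (λ j → u j xor u′ j) i ≡ pivotMap u i xor pivotMap u′ i
  pivotMap-xor u u′ i with i ≟ v | i ≟ w
  ... | yes _ | _     = refl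
  ... | no _  | yes _ = refl
  ... | no _  | no _  = distribute (u i) (u′ i) (u v) (u′ v) (u w) (u′ w) (A w i) (A v i)
    where
    distribute : ∀ a a′ b b′ c c′ p q →
      (a xor a′) xor (((b xor b′) ∧ p) xor ((c xor c′) ∧ q))
      ≡ (a xor ((b ∧ p) xor (c ∧ q))) xor (a′ xor ((b′ ∧ p) xor (c′ ∧ q)))
    distribute = byTruthTable 8

  pivotMap-∧ : ∀ t u i → pivotMap (λ j → t ∧ u j) i ≡ t ∧ pivotMap u i
  pivotMap-∧ t u i with i ≟ v | i ≟ w
  ... | yes _ | _     = refl
  ... | no _  | yes _ = refl
  ... | no _  | no _  = distribute t (u i) (u v) (u w) (A w i) (A v i)
    where
    distribute : ∀ t a b c p q →
      (t ∧ a) xor (((t ∧ b) ∧ p) xor ((t ∧ c) ∧ q)) ≡ t ∧ (a xor ((b ∧ p) xor (c ∧ q)))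
    distribute = byTruthTable 6

  open LinearMap pivotMap pivotMap-xor pivotMap-∧

  pivotMap-at-v : ∀ u → pivotMap u v ≡ u w
  pivotMap-at-v u with v ≟ v | v ≟ w
  ... | yes _   | _ = refl
  ... | no v≢v  | _ = ⊥-elim (v≢v refl)

  pivotMap-at-w : ∀ u → pivotMap u w ≡ u v
  pivotMap-at-w u with w ≟ v | w ≟ w
  ... | yes w≡v | _     = ⊥-elim (w≢v w≡v)
  ... | no _    | yes _ = refl
  ... | no _    | no w≢w = ⊥-elim (w≢w refl)

  pivotMap-zero : ∀ {u} → IsZero u → IsZero (pivotMap u)
  pivotMap-zero {u} u≡0 i with i ≟ v | i ≟ w
  ... | yes _ | _     = u≡0 w
  ... | no _  | yes _ = u≡0 v
  ... | no _  | no _  rewrite u≡0 i | u≡0 v | u≡0 w = refl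

  pivotMap-injective : ∀ {u} → IsZero (pivotMap u) → IsZero u
  pivotMap-injective {u} Lu≡0 i with i ≟ v | i ≟ w | Lu≡0 i
  ... | yes refl | _        | _ = trans (sym (pivotMap-at-w u)) (Lu≡0 w)
  ... | no _     | yes refl | _ = trans (sym (pivotMap-at-v u)) (Lu≡0 v)
  ... | no _     | no _     | Lui≡0
    rewrite trans (sym (pivotMap-at-w u)) (Lu≡0 w) | trans (sym (pivotMap-at-v u)) (Lu≡0 v) =
    trans (sym (xor-identityʳ (u i))) Lui≡0

  by-position : {P : Fin n → Set} → P v → P w → (∀ {i} → i ≢ v → i ≢ w → P i) → ∀ i → P i
  by-position at-v at-w off i with i ≟ v | i ≟ w
  ... | yes refl | _        = at-v
  ... | no _     | yes refl = at-w
  ... | no i≢v   | no i≢w   = off i≢v i≢w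

  pivotMap-off : ∀ u {i} → i ≢ v → i ≢ w → pivotMap u i ≡ u i xor ((u v ∧ A w i) xor (u w ∧ A v i))
  pivotMap-off u {i} i≢v i≢w with i ≟ v | i ≟ w
  ... | yes i≡v | _       = ⊥-elim (i≢v i≡v)
  ... | no _    | yes i≡w = ⊥-elim (i≢w i≡w)
  ... | no _    | no _    = refl

  pivotMap-unit-v : ∀ i → pivotMap (column A (v , φ)) i ≡ not ⌊ i ≟ v ⌋ ∧ Aᵛʷ i v
  pivotMap-unit-v = by-position at-v at-w off
    where
    at-v : pivotMap (column A (v , φ)) v ≡ not ⌊ v ≟ v ⌋ ∧ Aᵛʷ v v
    at-v rewrite pivotMap-at-v (column A (v , φ)) | ≟-≢ w≢v | ≟-refl v = refl
    at-w : pivotMap (column A (v , φ)) w ≡ not ⌊ w ≟ v ⌋ ∧ Aᵛʷ w v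
    at-w rewrite pivot-wv | pivotMap-at-w (column A (v , φ)) | ≟-refl v | ≟-≢ w≢v = refl
    off : ∀ {i} → i ≢ v → i ≢ w → pivotMap (column A (v , φ)) i ≡ not ⌊ i ≟ v ⌋ ∧ Aᵛʷ i v
    off {i} i≢v i≢w rewrite pivot-col-v i≢v i≢w | pivotMap-off (column A (v , φ)) i≢v i≢w
                          | ≟-≢ i≢v | ≟-refl v | ≟-≢ w≢v = xor-identityʳ (A w i)

  pivotMap-adj-v : ∀ i → pivotMap (column A (v , χ)) i ≡ ⌊ i ≟ v ⌋ ∨ (A v v ∧ Aᵛʷ i v)
  pivotMap-adj-v = by-position at-v at-w off
    where
    at-v : pivotMap (column A (v , χ)) v ≡ ⌊ v ≟ v ⌋ ∨ (A v v ∧ Aᵛʷ v v)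
    at-v rewrite pivotMap-at-v (column A (v , χ)) | ≟-refl v = Awv
    at-w : pivotMap (column A (v , χ)) w ≡ ⌊ w ≟ v ⌋ ∨ (A v v ∧ Aᵛʷ w v)
    at-w rewrite pivot-wv | pivotMap-at-w (column A (v , χ)) | ≟-≢ w≢v = sym (∧-identityʳ (A v v))
    off : ∀ {i} → i ≢ v → i ≢ w → pivotMap (column A (v , χ)) i ≡ ⌊ i ≟ v ⌋ ∨ (A v v ∧ Aᵛʷ i v)
    off {i} i≢v i≢w rewrite pivot-col-v i≢v i≢w | pivotMap-off (column A (v , χ)) i≢v i≢w
                          | ≟-≢ i≢v | Awv | symA i v = cancel (A v i) (A v v) (A w i)
      where
      cancel : ∀ a b c → a xor ((b ∧ c) xor (true ∧ a)) ≡ b ∧ c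
      cancel = byTruthTable 3

  pivotMap-unit-w : ∀ i → pivotMap (column A (w , φ)) i ≡ not ⌊ i ≟ w ⌋ ∧ Aᵛʷ i w
  pivotMap-unit-w = by-position at-v at-w off
    where
    at-v : pivotMap (column A (w , φ)) v ≡ not ⌊ v ≟ w ⌋ ∧ Aᵛʷ v w
    at-v rewrite pivot-vw | pivotMap-at-v (column A (w , φ)) | ≟-refl w | ≟-≢ v≢w = refl
    at-w : pivotMap (column A (w , φ)) w ≡ not ⌊ w ≟ w ⌋ ∧ Aᵛʷ w w
    at-w rewrite pivotMap-at-w (column A (w , φ)) | ≟-≢ v≢w | ≟-refl w = refl
    off : ∀ {i} → i ≢ v → i ≢ w → pivotMap (column A (w , φ)) i ≡ not ⌊ i ≟ w ⌋ ∧ Aᵛʷ i w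
    off {i} i≢v i≢w rewrite pivot-col-w i≢v i≢w | pivotMap-off (column A (w , φ)) i≢v i≢w
                          | ≟-≢ i≢w | ≟-≢ v≢w | ≟-refl w = refl

  pivotMap-adj-w : ∀ i → pivotMap (column A (w , χ)) i ≡ ⌊ i ≟ w ⌋ ∨ (A w w ∧ Aᵛʷ i w)
  pivotMap-adj-w = by-position at-v at-w off
    where
    at-v : pivotMap (column A (w , χ)) v ≡ ⌊ v ≟ w ⌋ ∨ (A w w ∧ Aᵛʷ v w)
    at-v rewrite pivot-vw | pivotMap-at-v (column A (w , χ)) | ≟-≢ v≢w = sym (∧-identityʳ (A w w))
    at-w : pivotMap (column A (w , χ)) w ≡ ⌊ w ≟ w ⌋ ∨ (A w w ∧ Aᵛʷ w w)
    at-w rewrite pivotMap-at-w (column A (w , χ)) | ≟-refl w = Avw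
    off : ∀ {i} → i ≢ v → i ≢ w → pivotMap (column A (w , χ)) i ≡ ⌊ i ≟ w ⌋ ∨ (A w w ∧ Aᵛʷ i w)
    off {i} i≢v i≢w rewrite pivot-col-w i≢v i≢w | pivotMap-off (column A (w , χ)) i≢v i≢w
                          | ≟-≢ i≢w | Avw | symA i w = cancel (A w i) (A w w) (A v i)
      where
      cancel : ∀ a b c → a xor ((true ∧ a) xor (b ∧ c)) ≡ b ∧ c
      cancel = byTruthTable 3

  pivotMap-unit-off : ∀ {x} → x ≢ v → x ≢ w →
                      ∀ i → pivotMap (column A (x , φ)) i ≡ column Aᵛʷ (x , φ) i
  pivotMap-unit-off {x} x≢v x≢w = by-position at-v at-w off
    where
    at-v : pivotMap (column A (x , φ)) v ≡ ⌊ v ≟ x ⌋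
    at-v rewrite pivotMap-at-v (column A (x , φ)) | ≟-≢ (≢-sym x≢w) | ≟-≢ (≢-sym x≢v) = refl
    at-w : pivotMap (column A (x , φ)) w ≡ ⌊ w ≟ x ⌋
    at-w rewrite pivotMap-at-w (column A (x , φ)) | ≟-≢ (≢-sym x≢w) | ≟-≢ (≢-sym x≢v) = refl
    off : ∀ {i} → i ≢ v → i ≢ w → pivotMap (column A (x , φ)) i ≡ ⌊ i ≟ x ⌋
    off {i} i≢v i≢w rewrite pivotMap-off (column A (x , φ)) i≢v i≢w
                          | ≟-≢ (≢-sym x≢w) | ≟-≢ (≢-sym x≢v) = xor-identityʳ ⌊ i ≟ x ⌋

  pivotMap-adj-off : ∀ {x} → x ≢ v → x ≢ w →
                     ∀ i → pivotMap (column A (x , χ)) i ≡ column Aᵛʷ (x , χ) i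
  pivotMap-adj-off {x} x≢v x≢w = by-position at-v at-w off
    where
    at-v : pivotMap (column A (x , χ)) v ≡ Aᵛʷ v x
    at-v = trans (pivotMap-at-v (column A (x , χ))) (sym (pivot-row-v x≢v x≢w))
    at-w : pivotMap (column A (x , χ)) w ≡ Aᵛʷ w x
    at-w = trans (pivotMap-at-w (column A (x , χ))) (sym (pivot-row-w x≢v x≢w))
    off : ∀ {i} → i ≢ v → i ≢ w → pivotMap (column A (x , χ)) i ≡ Aᵛʷ i x
    off i≢v i≢w = trans (pivotMap-off (column A (x , χ)) i≢v i≢w) (sym (pivot-outside i≢v i≢w x≢v x≢w))

  cellSwap : Fin n → Col → Col
  cellSwap x with x ≟ v | x ≟ w
  ... | yes _ | _     = loopSwap (A x x)
  ... | no _  | yes _ = loopSwap (A x x)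
  ... | no _  | no _  = id

  cellSwap-admissible : ∀ x → Admissible (A x x) (cellSwap x)
  cellSwap-admissible x with x ≟ v | x ≟ w
  ... | yes _ | _     = swaps λ _ → refl
  ... | no _  | yes _ = swaps λ _ → refl
  ... | no _  | no _  = keeps λ _ → refl

  cellSwap-v : ∀ ι → cellSwap v ι ≡ loopSwap (A v v) ι
  cellSwap-v ι with v ≟ v
  ... | yes _  = refl
  ... | no v≢v = ⊥-elim (v≢v refl)

  cellSwap-w : ∀ ι → cellSwap w ι ≡ loopSwap (A w w) ι
  cellSwap-w ι with w ≟ v | w ≟ w
  ... | yes _ | _      = refl
  ... | no _  | yes _  = refl
  ... | no _  | no w≢w = ⊥-elim (w≢w refl)

  cellSwap-off : ∀ {x} → x ≢ v → x ≢ w → ∀ ι → cellSwap x ι ≡ ι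
  cellSwap-off {x} x≢v x≢w ι with x ≟ v | x ≟ w
  ... | yes x≡v | _       = ⊥-elim (x≢v x≡v)
  ... | no _    | yes x≡w = ⊥-elim (x≢w x≡w)
  ... | no _    | no _    = refl

  PivotsColumn : Col → Fin n → Set
  PivotsColumn ι x = ∀ i → pivotMap (column A (x , ι)) i ≡ column Aᵛʷ (x , cellSwap x ι) i

  pivotMap-column-φ : ∀ x → PivotsColumn φ x
  pivotMap-column-φ = by-position at-v at-w off
    where
    at-v : PivotsColumn φ v
    at-v i = begin
      pivotMap (column A (v , φ)) i          ≡⟨ pivotMap-unit-v i ⟩
      not ⌊ i ≟ v ⌋ ∧ Aᵛʷ i v                ≡⟨ sym (column-loopSwap-φ Aᵛʷ (pivot-diag A v w v) i) ⟩
      column Aᵛʷ (v , loopSwap (A v v) φ) i  ≡⟨ cong (λ κ → column Aᵛʷ (v , κ) i) (sym (cellSwap-v φ)) ⟩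
      column Aᵛʷ (v , cellSwap v φ) i        ∎
    at-w : PivotsColumn φ w
    at-w i = begin
      pivotMap (column A (w , φ)) i          ≡⟨ pivotMap-unit-w i ⟩
      not ⌊ i ≟ w ⌋ ∧ Aᵛʷ i w                ≡⟨ sym (column-loopSwap-φ Aᵛʷ (pivot-diag A v w w) i) ⟩
      column Aᵛʷ (w , loopSwap (A w w) φ) i  ≡⟨ cong (λ κ → column Aᵛʷ (w , κ) i) (sym (cellSwap-w φ)) ⟩
      column Aᵛʷ (w , cellSwap w φ) i        ∎
    off : ∀ {x} → x ≢ v → x ≢ w → PivotsColumn φ x
    off {x} x≢v x≢w i = trans (pivotMap-unit-off x≢v x≢w i)
                              (cong (λ κ → column Aᵛʷ (x , κ) i) (sym (cellSwap-off x≢v x≢w φ)))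

  pivotMap-column-χ : ∀ x → PivotsColumn χ x
  pivotMap-column-χ = by-position at-v at-w off
    where
    at-v : PivotsColumn χ v
    at-v i = begin
      pivotMap (column A (v , χ)) i          ≡⟨ pivotMap-adj-v i ⟩
      ⌊ i ≟ v ⌋ ∨ (A v v ∧ Aᵛʷ i v)          ≡⟨ sym (column-loopSwap-χ Aᵛʷ (pivot-diag A v w v) i) ⟩
      column Aᵛʷ (v , loopSwap (A v v) χ) i  ≡⟨ cong (λ κ → column Aᵛʷ (v , κ) i) (sym (cellSwap-v χ)) ⟩
      column Aᵛʷ (v , cellSwap v χ) i        ∎
    at-w : PivotsColumn χ w
    at-w i = begin
      pivotMap (column A (w , χ)) i          ≡⟨ pivotMap-adj-w i ⟩
      ⌊ i ≟ w ⌋ ∨ (A w w ∧ Aᵛʷ i w)          ≡⟨ sym (column-loopSwap-χ Aᵛʷ (pivot-diag A v w w) i) ⟩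
      column Aᵛʷ (w , loopSwap (A w w) χ) i  ≡⟨ cong (λ κ → column Aᵛʷ (w , κ) i) (sym (cellSwap-w χ)) ⟩
      column Aᵛʷ (w , cellSwap w χ) i        ∎
    off : ∀ {x} → x ≢ v → x ≢ w → PivotsColumn χ x
    off {x} x≢v x≢w i = trans (pivotMap-adj-off x≢v x≢w i)
                              (cong (λ κ → column Aᵛʷ (x , κ) i) (sym (cellSwap-off x≢v x≢w χ)))

  pivotMap-column : ∀ x ι → PivotsColumn ι x
  pivotMap-column x φ = pivotMap-column-φ x
  pivotMap-column x χ = pivotMap-column-χ x
  pivotMap-column x ψ =
    L-column-ψ {M = A} {Aᵛʷ} (cellSwap-admissible x) x x (pivotMap-column-φ x) (pivotMap-column-χ x)

  swapCells : Ground n → Ground n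
  swapCells (x , ι) = x , cellSwap x ι

  swapCells-involutive : ∀ e → swapCells (swapCells e) ≡ e
  swapCells-involutive (x , ι) = cong (x ,_) (admissible-involutive (cellSwap-admissible x) ι)

  pivotIso : Ground n ↔ Ground n
  pivotIso = mk↔ₛ′ swapCells swapCells swapCells-involutive swapCells-involutive

  sumCols-pivot : ∀ T i → sumCols Aᵛʷ (T ∘ swapCells) i ≡ pivotMap (sumCols A T) i
  sumCols-pivot T i = begin
    bigXor (λ x → cellSum (λ κ → T (x , cellSwap x κ) ∧ column Aᵛʷ (x , κ) i))
      ≡⟨ bigXor-cong reindex ⟩
    bigXor (λ x → cellSum (λ ι → T (x , ι) ∧ column Aᵛʷ (x , cellSwap x ι) i))
      ≡⟨ bigXor-cong (λ x → cellSum-cong λ ι → cong (T (x , ι) ∧_) (sym (pivotMap-column x ι i))) ⟩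
    bigXor (λ x → cellSum (λ ι → T (x , ι) ∧ pivotMap (column A (x , ι)) i))
      ≡⟨ sym (L-sumCols A T i) ⟩
    pivotMap (sumCols A T) i ∎
    where
    reindex : ∀ x → cellSum (λ κ → T (x , cellSwap x κ) ∧ column Aᵛʷ (x , κ) i)
                  ≡ cellSum (λ ι → T (x , ι) ∧ column Aᵛʷ (x , cellSwap x ι) i)
    reindex x = trans (sym (cellSum-admissible (cellSwap-admissible x) g))
                      (cellSum-cong λ ι → cong (λ κ → T (x , κ) ∧ column Aᵛʷ (x , cellSwap x ι) i)
                                               (admissible-involutive (cellSwap-admissible x) ι))
      where
      g : Col → Bool
      g κ = T (x , cellSwap x κ) ∧ column Aᵛʷ (x , κ) i

  pivotIso-isMatroidIso : IsMatroidIso A Aᵛʷ pivotIso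
  pivotIso-isMatroidIso =
    isMatroidIso-byLinearMap pivotIso pivotMap pivotMap-zero pivotMap-injective sumCols-pivot

  good-pivot⁻ : {B : Mat m} {X : Ground n ↔ Ground m} → Good Aᵛʷ B X → Good A B (X ↔-∘ pivotIso)
  good-pivot⁻ = good-∘-cellwise {γ = pivotIso} cellSwap (λ _ _ → refl)
    pivotIso-isMatroidIso cellSwap-admissible (pivot-diag A v w)

  good-pivot⁺ : {B : Mat m} {β : Ground n ↔ Ground m} → Good A B β → Good Aᵛʷ B (β ↔-∘ ↔-sym pivotIso)
  good-pivot⁺ = good-∘-cellwise {γ = ↔-sym pivotIso} cellSwap (λ _ _ → refl)
    (isMatroidIso-sym {A = A} {Aᵛʷ} {pivotIso} pivotIso-isMatroidIso)
    (λ x → subst (λ b → Admissible b (cellSwap x)) (sym (pivot-diag A v w x)) (cellSwap-admissible x))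
    (λ x → sym (pivot-diag A v w x))

-- (1) ⇒ (2)

liftIso : Fin n ↔ Fin m → Ground n ↔ Ground m
liftIso σ = mk↔ₛ′ (map₁ (to σ)) (map₁ (from σ))
                  (λ (y , ι) → cong (_, ι) (strictlyInverseˡ σ y))
                  (λ (x , ι) → cong (_, ι) (strictlyInverseʳ σ x))

graphIso⇒good : {A : Mat n} {B : Mat m} → GraphIso A B → ∃ (Good A B)
graphIso⇒good {n} {m} {A} {B} (σ , entries) =
  liftIso σ , mkGood iso (λ v → to σ v , λ _ → refl) (λ _ → keeps λ _ → refl)
  where
  τ : Fin m → Fin n
  τ = from σ
  B≡Aτ : ∀ j y → B j y ≡ A (τ j) (τ y)
  B≡Aτ j y = trans (cong₂ B (sym (strictlyInverseˡ σ j)) (sym (strictlyInverseˡ σ y))) (entries (τ j) (τ y))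
  sumCols-lift : ∀ T j → sumCols B (T ∘ map₁ τ) j ≡ sumCols A T (τ j)
  sumCols-lift T j = begin
    sumCols B (T ∘ map₁ τ) j
      ≡⟨ sumCols-formula B (T ∘ map₁ τ) j ⟩
    φψ-part (τ j) xor bigXor (λ y → (T (τ y , χ) xor T (τ y , ψ)) ∧ B j y)
      ≡⟨ cong (φψ-part (τ j) xor_)
              (bigXor-cong λ y → cong ((T (τ y , χ) xor T (τ y , ψ)) ∧_) (B≡Aτ j y)) ⟩
    φψ-part (τ j) xor bigXor (χψ-part ∘ τ)
      ≡⟨ cong (φψ-part (τ j) xor_) (bigXor-permute (↔-sym σ) χψ-part) ⟩
    φψ-part (τ j) xor bigXor χψ-part
      ≡⟨ sym (sumCols-formula A T (τ j)) ⟩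
    sumCols A T (τ j) ∎
    where
    φψ-part : Fin _ → Bool
    φψ-part x = T (x , φ) xor T (x , ψ)
    χψ-part : Fin _ → Bool
    χψ-part x = (T (x , χ) xor T (x , ψ)) ∧ A (τ j) x
  iso : IsMatroidIso A B (liftIso σ)
  iso = isMatroidIso-byLinearMap {A = A} {B} (liftIso σ) (λ u j → u (τ j)) (λ u≡0 j → u≡0 (τ j))
          (λ {u} Lu≡0 i → trans (cong u (sym (strictlyInverseʳ σ i))) (Lu≡0 (to σ i))) sumCols-lift

good-pivots⁻ : {A C : Mat n} {B : Mat m} → Symmetric A → Pivots A C → ∃ (Good C B) → ∃ (Good A B)
good-pivots⁻ symA ε good = good
good-pivots⁻ symA (step v w v≢w Avw ◅ steps) good =
  let X , X-good = good-pivots⁻ (pivot-symmetric symA v w) steps good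
  in X ↔-∘ pivotIso , good-pivot⁻ X-good
  where open Pivot symA v≢w Avw using (pivotIso; good-pivot⁻)

pivotEquivalent⇒goodCompatibleIso : {A : Mat n} {B : Mat m} → Symmetric A →
                                     PivotEquivalentUpToIso A B → GoodCompatibleIso A B
pivotEquivalent⇒goodCompatibleIso symA (C , steps , C≅B) =
  let β , good = good-pivots⁻ symA steps (graphIso⇒good C≅B)
  in good⇒goodCompatibleIso {β = β} good

-- (2) ⇒ (1)

∈-tabulate⁻ : {f : Fin n → Bool} {x : Fin n} → x ∈ tabulate f → f x ≡ true
∈-tabulate⁻ {f = f} {x} x∈ = trans (sym (lookup∘tabulate f x)) ([]=⇒lookup x∈)

∈-tabulate⁺ : {f : Fin n → Bool} {x : Fin n} → f x ≡ true → x ∈ tabulate f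
∈-tabulate⁺ {f = f} {x} fx = lookup⇒[]= x (tabulate f) (trans (lookup∘tabulate f x) fx)

moved : Ground n ↔ Ground m → VertexSet n
moved β = tabulate (movesφ ∘ fβ β)

module _ {A : Mat n} {B : Mat m} {β : Ground n ↔ Ground m} (good : Good A B β) where

  open Good good renaming (isMatroidIso to iso; compatible to compat; admissible to adm)

  φ-preimage-independent : Independent A (λ e → isφ (proj₂ (to β e)))
  φ-preimage-independent = proj₂ (iso _)
    (independent-cong B (λ e → cong (isφ ∘ proj₂) (sym (strictlyInverseˡ β e))) (independent-φ B))

  moved-neighbour : Symmetric A → ∀ {v} → movesφ (fβ β v) ≡ true →
                    ∃ λ w → w ≢ v × A v w ≡ true × movesφ (fβ β w) ≡ true
  moved-neighbour symA {v} v-moves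
    with any? (λ w → ¬? (w ≟ v) ×-dec (A v w Bool.≟ true) ×-dec (movesφ (fβ β w) Bool.≟ true))
  ... | yes found = found
  ... | no none   = ⊥-elim (φ-preimage-independent (dependent-mono A N⊆S (neighbourCells-dependent A v)))
    where
    neighbour-fixes : ∀ x → x ≢ v → A v x ≡ true → movesφ (fβ β x) ≡ false
    neighbour-fixes x x≢v Avx with movesφ (fβ β x) in x-moves
    ... | false = refl
    ... | true  = ⊥-elim (none (x , x≢v , Avx , x-moves))
    N⊆S : ∀ e → neighbourCells A v e ≡ true → isφ (proj₂ (to β e)) ≡ true
    N⊆S (x , φ) N with x ≟ v
    ... | yes refl with () ← N
    ... | no x≢v   = cong isφ (admissible-fixing (adm x) (neighbour-fixes x x≢v (trans (symA v x) N)) φ)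
    N⊆S (x , χ) N with ≟-true {x = x} {v} (∧-conicalˡ _ (not (A v v)) N)
    ... | refl = trans (cong isφ (admissible-moving (adm x) v-moves χ))
                       (trans (isφ-loopSwap-χ (A x x)) (∧-conicalʳ _ _ N))
    N⊆S (x , ψ) N with ≟-true {x = x} {v} (∧-conicalˡ _ (A v v) N)
    ... | refl = trans (cong isφ (admissible-moving (adm x) v-moves ψ))
                       (trans (isφ-loopSwap-ψ (A x x)) (∧-conicalʳ _ _ N))

  fixing⇒graphIso : (∀ x → movesφ (fβ β x) ≡ false) → GraphIso A B
  fixing⇒graphIso fixes = σ , entries
    where
    s : Fin n → Fin m
    s x = proj₁ (compat x)
    to-β : ∀ x ι → to β (x , ι) ≡ (s x , ι)
    to-β x ι = cong₂ _,_ (proj₂ (compat x) ι) (admissible-fixing (adm x) (fixes x) ι)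
    τ : Fin m → Fin n
    τ y = proj₁ (from β (y , φ))
    sτ : ∀ y → s (τ y) ≡ y
    sτ y = cong proj₁ (trans (sym (to-β (τ y) (proj₂ (from β (y , φ))))) (strictlyInverseˡ β (y , φ)))
    τs : ∀ x → τ (s x) ≡ x
    τs x = cong proj₁ (trans (cong (from β) (sym (to-β x φ))) (strictlyInverseʳ β (x , φ)))
    σ : Fin n ↔ Fin m
    σ = mk↔ₛ′ s τ sτ τs
    from-β : ∀ y ι → from β (y , ι) ≡ (τ y , ι)
    from-β y ι = begin
      from β (y , ι)             ≡⟨ cong (λ y′ → from β (y′ , ι)) (sym (sτ y)) ⟩
      from β (s (τ y) , ι)       ≡⟨ cong (from β) (sym (to-β (τ y) ι)) ⟩
      from β (to β (τ y , ι))    ≡⟨ strictlyInverseʳ β (τ y , ι) ⟩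
      (τ y , ι)                  ∎
    image : ∀ i j e → basisExchange (s i) (s j) e ≡ basisExchange i j (from β e)
    image i j (y , ι) rewrite from-β y ι with ι
    ... | φ = cong not (≟-inverse σ y i)
    ... | χ = ≟-inverse σ y j
    ... | ψ = refl
    entries : ∀ i j → B (s i) (s j) ≡ A i j
    entries i j = ⇔→≡ (mk⇔ B⇒A A⇒B)
      where
      open Equivalence
      B⇒A : B (s i) (s j) ≡ true → A i j ≡ true
      B⇒A Bij = to (independent-basisExchange A i j)
        (proj₂ (iso (basisExchange i j))
          (independent-cong B (image i j) (from (independent-basisExchange B (s i) (s j)) Bij)))
      A⇒B : A i j ≡ true → B (s i) (s j) ≡ true
      A⇒B Aij = to (independent-basisExchange B (s i) (s j))
        (independent-cong B (sym ∘ image i j)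
          (proj₁ (iso (basisExchange i j)) (from (independent-basisExchange A i j) Aij)))

  pivot-fewer-moved : (symA : Symmetric A) {v w : Fin n} (v≢w : v ≢ w) (Avw : A v w ≡ true) →
    movesφ (fβ β v) ≡ true → movesφ (fβ β w) ≡ true →
    moved (β ↔-∘ ↔-sym (Pivot.pivotIso symA v≢w Avw)) ⊂ moved β
  pivot-fewer-moved symA {v} {w} v≢w Avw v-moves w-moves =
    (λ {x} → by-position {P = λ x → x ∈ moved β′ → x ∈ moved β}
               (λ _ → ∈-tabulate⁺ v-moves) (λ _ → ∈-tabulate⁺ w-moves) off x) ,
    v , ∈-tabulate⁺ v-moves , λ v∈ → contradiction (trans (sym (∈-tabulate⁻ v∈)) v-fixed) λ ()
    where
    open Pivot symA v≢w Avw using (pivotIso; cellSwap; cellSwap-v; cellSwap-off; by-position)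
    β′ : Ground n ↔ Ground m
    β′ = β ↔-∘ ↔-sym pivotIso
    off : ∀ {x} → x ≢ v → x ≢ w → x ∈ moved β′ → x ∈ moved β
    off {x} x≢v x≢w x∈ =
      ∈-tabulate⁺ (trans (cong (not ∘ isφ ∘ fβ β x) (sym (cellSwap-off x≢v x≢w φ))) (∈-tabulate⁻ x∈))
    v-fixed : movesφ (fβ β′ v) ≡ false
    v-fixed = cong (not ∘ isφ) (begin
      fβ β v (cellSwap v φ)               ≡⟨ admissible-moving (adm v) v-moves _ ⟩
      loopSwap (A v v) (cellSwap v φ)     ≡⟨ cong (loopSwap (A v v)) (cellSwap-v φ) ⟩
      loopSwap (A v v) (loopSwap (A v v) φ) ≡⟨ loopSwap-involutive (A v v) φ ⟩
      φ                                   ∎)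

pivot-then : {A A′ : Mat n} {B : Mat m} →
             PivotStep A A′ → PivotEquivalentUpToIso A′ B → PivotEquivalentUpToIso A B
pivot-then s (C , steps , C≅B) = C , s ◅ steps , C≅B

good⇒pivotEquivalent : {A : Mat n} {B : Mat m} → Symmetric A → (β : Ground n ↔ Ground m) → Good A B β →
                       Acc _⊂_ (moved β) → PivotEquivalentUpToIso A B
good⇒pivotEquivalent {A = A} {B} symA β good (acc smaller) with nonempty? (moved β)
... | no nothing-moved = A , ε , fixing⇒graphIso good fixes
  where
  fixes : ∀ x → movesφ (fβ β x) ≡ false
  fixes x with movesφ (fβ β x) in x-moves
  ... | false = refl
  ... | true  = ⊥-elim (nothing-moved (x , ∈-tabulate⁺ x-moves))
... | yes (v , v∈) with moved-neighbour good symA (∈-tabulate⁻ v∈)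
... | w , w≢v , Avw , w-moves =
  pivot-then {B = B} (step v w v≢w Avw)
    (good⇒pivotEquivalent symAᵛʷ (β ↔-∘ ↔-sym pivotIso) (good-pivot⁺ good)
                          (smaller (pivot-fewer-moved good symA v≢w Avw (∈-tabulate⁻ v∈) w-moves)))
  where
  v≢w : v ≢ w
  v≢w = ≢-sym w≢v
  open Pivot symA v≢w Avw using (symAᵛʷ; pivotIso; good-pivot⁺)

goodCompatibleIso⇒pivotEquivalent : {A : Mat n} {B : Mat m} → Symmetric A →
                                     GoodCompatibleIso A B → PivotEquivalentUpToIso A B
goodCompatibleIso⇒pivotEquivalent symA G =
  good⇒pivotEquivalent symA (proj₁ G) (goodCompatibleIso⇒good G) (⊂-wellFounded (moved (proj₁ G)))

theorem14 : ∀ (n m : ℕ) (G₁ : Mat n) (G₂ : Mat m) →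
    Symmetric G₁ → Symmetric G₂ →
    (PivotEquivalentUpToIso G₁ G₂ → GoodCompatibleIso G₁ G₂)
      × (GoodCompatibleIso G₁ G₂ → PivotEquivalentUpToIso G₁ G₂)
theorem14 n m G₁ G₂ symG₁ _ =
  pivotEquivalent⇒goodCompatibleIso symG₁ , goodCompatibleIso⇒pivotEquivalent symG₁
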